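{- (i) For positive integers $a<b<c$: $\mathbf v_{bc}\mathbf v_{ab}\mathbf v_{bc}\equiv\mathbf v_{ab}\mathbf v_{bc}\mathbf v_{ab}\equiv\mathbf 0$. (ii) For positive integers $a<b<c$: $\mathbf v_{ca}\mathbf v_{bc}\mathbf v_{ca}\equiv\mathbf v_{ab}\mathbf v_{ca}\mathbf v_{ab}\equiv\mathbf v_{bc}\mathbf v_{ca}\mathbf v_{bc}\equiv\mathbf v_{ca}\mathbf v_{ab}\mathbf v_{ca}\equiv\mathbf 0$. (iii) For positive integers $a<b<c<d$: $\mathbf v_{ac}\mathbf v_{da}\mathbf v_{bd}\equiv\mathbf v_{bd}\mathbf v_{ab}\mathbf v_{ca}\equiv\mathbf v_{ca}\mathbf v_{bc}\mathbf v_{bd}\equiv\mathbf v_{db}\mathbf v_{cd}\mathbf v_{ac}\equiv\mathbf v_{bd}\mathbf v_{da}\mathbf v_{ac}\equiv\mathbf v_{ac}\mathbf v_{cd}\mathbf v_{db}\equiv\mathbf v_{db}\mathbf v_{bc}\mathbf v_{ca}\equiv\mathbf v_{ca}\mathbf v_{ab}\mathbf v_{bd}\equiv\mathbf 0$.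
   Context: For a positive integer $N$, $[N]=\{1,\dots,N\}$, $S_N$ is the symmetric group on $[N]$, $s_{ab}$ the transposition exchanging $a,b$, $\ell$ the number of inversions. With commuting indeterminates $q_1,\dots,q_{N-1}$, $\mathbf q^\alpha=\prod q_i^{\alpha_i}$, $\mathbf q_{ij}=q_i\cdots q_{j-1}$ ($i<j$), $S_N[\mathbf q]=\{\mathbf q^\alpha w\}$, $\ell(\mathbf q^\alpha w)=\ell(w)+2\deg\mathbf q^\alpha$. For $k\in[N-1]$ the quantum $k$-Bruhat order has covers, for $w\in S_N$ and $i\le k<j$: $w\lessdot_k ws_{ij}$ if $\ell(ws_{ij})=\ell(w)+1$, $w\lessdot_k\mathbf q_{ij}ws_{ij}$ if $\ell(\mathbf q_{ij}ws_{ij})=\ell(w)+1$; extended $\mathbf q$-multiplicatively. Operators $\mathbf v_{ab}$ ($a\neq b$ positive integers) generate a free monoid, with zero element $\mathbf 0$. For indices in $[N]$, $k\in[N-1]$, $u\in S_N$: $\mathbf v_{ab}\bullet_ku=s_{ab}u$ if $a<b$ and $u\lessdot_ks_{ab}u$; $=\mathbf q_{ij}s_{ab}u$ if $a>b$, $i=u^{ -1}(a)$, $j=u^{ -1}(b)$ and $u\lessdot_k\mathbf q_{ij}s_{ab}u$; $=0$ otherwise; extended by $\mathbf v\bullet_k(\mathbf q^\alpha u)=\mathbf q^\alpha(\mathbf v\bullet_ku)$, $\bullet_k0=0$, compositions acting rightmost operator first. $\mathbf v\equiv\mathbf 0$ means $\mathbf v\bullet_kx=0$ for all $N$ with the indices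 in $[N]$, all $x\in S_N[\mathbf q]$, $k\in[N-1]$. -}

module Defs where

open import Data.Nat using (ℕ; zero; suc; _+_; _*_)
open import Data.Fin using (Fin; toℕ; _<_; _<?_)
open import Data.Fin.Permutation using (Permutation′; _⟨$⟩ʳ_; _⟨$⟩ˡ_)
import Data.Fin.Permutation.Components as PC
open import Data.List using (List; []; _∷_; length; filter; cartesianProduct; map)
open import Data.Nat.ListAction using (sum)
open import Data.List.Base using (allFin)
open import Data.Product using (_×_; _,_; Σ; ∃; ∃-syntax; proj₁; proj₂)
open import Data.Sum using (_⊎_)
open import Relation.Nullary using (¬_)
open import Relation.Nullary.Decidable using (_×-dec_)
open import Relation.Binary.PropositionalEquality using (_≡_)
import Data.Nat as ℕ

-- N = suc n.  A position / value p : Fin (suc n) stands for the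
-- positive integer toℕ p + 1 ∈ [N].  The quantum variables q₁,…,q_{N-1} are
-- indexed by m : Fin n (m stands for q_{toℕ m + 1}); likewise k : Fin n stands
-- for k = toℕ k + 1 ∈ [N-1].  A permutation w ∈ S_N is a bijection of Fin N,
-- read in one-line notation: w(p) is the value at position p.

Perm : ℕ → Set
Perm n = Permutation′ (suc n)

s : ∀ {n} → Fin (suc n) → Fin (suc n) → Fin (suc n) → Fin (suc n)
s a b = PC.transpose a b

-- exponent vectors of monomials q^α
Mono : ℕ → Set
Mono n = Fin n → ℕ

one : ∀ {n} → Mono n
one _ = 0

_·_ : ∀ {n} → Mono n → Mono n → Mono n
(α · β) m = α m + β m

deg : ∀ {n} → Mono n → ℕ
deg {n} α = sum (map α (allFin n))

-- q_ij = q_i ⋯ q_{j-1} (for i < j, i,j positions): q_m occurs iff i ≤ m < j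
-- (1-based), i.e. toℕ i ≤ toℕ m < toℕ j with the 0-based encodings above.
qq : ∀ {n} → Fin (suc n) → Fin (suc n) → Mono n
qq i j m with toℕ i ℕ.≤? toℕ m | toℕ m ℕ.<? toℕ j
... | Relation.Nullary.yes _ | Relation.Nullary.yes _ = 1
... | _ | _ = 0

-- elements q^α w of S_N[q]
QPerm : ℕ → Set
QPerm n = Mono n × Perm n

inv : ∀ {n} → Perm n → ℕ
inv {n} w = length (filter (λ pq → (proj₁ pq <? proj₂ pq) ×-dec
                                   ((w ⟨$⟩ʳ proj₂ pq) <? (w ⟨$⟩ʳ proj₁ pq)))
                           (cartesianProduct (allFin (suc n)) (allFin (suc n))))

ℓ : ∀ {n} → QPerm n → ℕ
ℓ (α , w) = inv w + 2 * deg α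

_≈ₘ_ : ∀ {n} → Mono n → Mono n → Set
α ≈ₘ β = ∀ m → α m ≡ β m

_≈ₚ_ : ∀ {n} → Perm n → Perm n → Set
u ≈ₚ w = ∀ p → u ⟨$⟩ʳ p ≡ w ⟨$⟩ʳ p

_≈_ : ∀ {n} → QPerm n → QPerm n → Set
(α , u) ≈ (β , w) = (α ≈ₘ β) × (u ≈ₚ w)

-- "w ≈ u s_ij" (right multiplication: swap the entries in positions i, j)
IsRightSwap : ∀ {n} → Perm n → Fin (suc n) → Fin (suc n) → Perm n → Set
IsRightSwap u i j w = ∀ p → w ⟨$⟩ʳ p ≡ u ⟨$⟩ʳ (s i j p)

-- "w ≈ s_ab u" (left multiplication: swap the values a, b)
IsLeftSwap : ∀ {n} → Fin (suc n) → Fin (suc n) → Perm n → Perm n → Set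
IsLeftSwap a b u w = ∀ p → w ⟨$⟩ʳ p ≡ s a b (u ⟨$⟩ʳ p)

-- covers of the quantum k-Bruhat order starting at w ∈ S_N:
--   w ⋖_k w s_ij          if ℓ(w s_ij) = ℓ(w) + 1,
--   w ⋖_k q_ij w s_ij     if ℓ(q_ij w s_ij) = ℓ(w) + 1,   with i ≤ k < j.
Cover : ∀ {n} → Fin n → Perm n → QPerm n → Set
Cover {n} k w (β , w′) =
  ∃[ i ] ∃[ j ] (toℕ i ℕ.≤ toℕ k × toℕ k ℕ.< toℕ j × IsRightSwap w i j w′ ×
    ((β ≈ₘ one) ⊎ (β ≈ₘ qq i j)) × ℓ (β , w′) ≡ inv w + 1)

-- v_ab •_k u = y ≠ 0  (u ∈ S_N); v_ab •_k u = 0 iff there is no such y.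
Step : ∀ {n} → Fin n → Fin (suc n) → Fin (suc n) → Perm n → QPerm n → Set
Step k a b u (β , w) =
    (a < b × β ≈ₘ one × IsLeftSwap a b u w × Cover k u (β , w))
  ⊎ (b < a × (u ⟨$⟩ˡ a) < (u ⟨$⟩ˡ b) × β ≈ₘ qq (u ⟨$⟩ˡ a) (u ⟨$⟩ˡ b)
       × IsLeftSwap a b u w × Cover k u (β , w))

StepQ : ∀ {n} → Fin n → Fin (suc n) → Fin (suc n) → QPerm n → QPerm n → Set
StepQ k a b (α , u) (γ , w) = ∃[ β ] (Step k a b u (β , w) × γ ≈ₘ (α · β))

-- a monomial word in the operators v_ab (listed left to right as written)
Word : ℕ → Set
Word n = List (Fin (suc n) × Fin (suc n))

-- Acts k v x y :  v •_k x = y ≠ 0 (rightmost operator acts first)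
data Acts {n} (k : Fin n) : Word n → QPerm n → QPerm n → Set where
  done : ∀ {x} → Acts k [] x x
  step : ∀ {a b v x y z} → Acts k v x y → StepQ k a b y z → Acts k ((a , b) ∷ v) x z

-- v ≡ 0 (for a fixed N = suc n containing all indices):  v •_k x = 0 for all
-- x ∈ S_N[q] and all k ∈ [N-1]
Vanishes : (n : ℕ) → Word n → Set
Vanishes n v = ∀ (k : Fin n) (x : QPerm n) (y : QPerm n) → ¬ Acts k v x y

-- A nonzero step v_xy •_k u = q^β w is a cover u ⋖_k q^β w with w = s_xy u = u s_ij and
-- i ≤ k < j: the values x and y sit at the positions i and j of u, on the two sides of the cut k,
-- and the step moves x to the right of the cut and y to its left.  Comparing the inversion counts
-- of u and u s_ij (Exchange.inversions-transpose) shows that in a classical cover (x < y) no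
-- position strictly between i and j carries a value strictly between x and y, while in a quantum
-- cover (y < x), whose length condition reads ℓ(u) − ℓ(u s_ij) = 2(j − i) − 1, every such
-- position does.  For each listed word, following the positions of its letters through the three
-- steps either makes a letter cross the cut twice in the same direction or violates one of these
-- gap conditions.

module Submission where

open import Defs
open import Data.Nat as ℕ using (ℕ; zero; suc; _+_; _*_; z≤n; s≤s)
import Data.Nat.Properties as ℕₚ
import Data.Nat.ListAction as List
open import Data.Nat.ListAction.Properties using (sum-++)
open import Data.Fin as Fin using (Fin; toℕ; _<_; _≤_)
import Data.Fin.Properties as Finₚ
open import Data.Fin.Permutation using (Permutation′; _⟨$⟩ʳ_; _⟨$⟩ˡ_)
import Data.Fin.Permutation as Perm
import Data.Fin.Permutation.Components as PC
open import Data.List using (List; []; _∷_; _++_; map; tabulate; allFin; cartesianProduct; filter; length)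
import Data.List.Properties as Listₚ
open import Data.Product using (_×_; _,_; proj₁; proj₂)
open import Data.Sum using (_⊎_; inj₁; inj₂)
open import Level using (Level)
open import Data.Bool using (true; false; if_then_else_)
open import Data.Empty using (⊥; ⊥-elim)
open import Relation.Binary.Definitions using (tri<; tri≈; tri>)
open import Function using (_∘_; id)
open import Data.Nat.Tactic.RingSolver using (solve-∀)
open import Relation.Nullary using (¬_; Dec; does; yes; no; _because_)
open import Relation.Nullary.Decidable using (_×-dec_; dec-true; dec-false; decidable-stable)
open import Relation.Unary using (Pred; Decidable)
open import Relation.Binary.PropositionalEquality hiding ([_])
open import Algebra.Properties.Semiring.Sum ℕₚ.+-*-semiring
  using (sum; sum-cong-≗; ∑-distrib-+; ∑-permute; *-distribˡ-sum; *-distribʳ-sum; sum-replicate-zero)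

private
  variable
    p : Level
    P Q : Set p
    N : ℕ

𝟙 : Dec P → ℕ
𝟙 P? = if does P? then 1 else 0

𝟙-yes : (P? : Dec P) → P → 𝟙 P? ≡ 1
𝟙-yes (yes _) _ = refl
𝟙-yes (no ¬x) x = ⊥-elim (¬x x)

𝟙-no : (P? : Dec P) → ¬ P → 𝟙 P? ≡ 0
𝟙-no (yes x) ¬x = ⊥-elim (¬x x)
𝟙-no (no _) _ = refl

𝟙≤1 : (P? : Dec P) → 𝟙 P? ℕ.≤ 1
𝟙≤1 (yes _) = s≤s z≤n
𝟙≤1 (no _) = z≤n

𝟙≡1⇒ : (P? : Dec P) → 𝟙 P? ≡ 1 → P
𝟙≡1⇒ (yes x) _ = x

𝟙-×-dec : (P? : Dec P) (Q? : Dec Q) → 𝟙 (P? ×-dec Q?) ≡ 𝟙 P? * 𝟙 Q?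
𝟙-×-dec (true because _) (true because _) = refl
𝟙-×-dec (true because _) (false because _) = refl
𝟙-×-dec (false because _) _ = refl

[_<_] : Fin N → Fin N → ℕ
[ x < y ] = 𝟙 (x Fin.<? y)

δ : Fin N → Fin N → ℕ
δ x y = 𝟙 (x Finₚ.≟ y)

between : Fin N → Fin N → Fin N → ℕ
between i j r = [ i < r ] * [ r < j ]

gap : Fin N → Fin N → ℕ
gap i j = sum (between i j)

module _ {x y : Fin N} where

  [<]≡1 : x < y → [ x < y ] ≡ 1
  [<]≡1 = 𝟙-yes (x Fin.<? y)

  [<]≡0 : y ≤ x → [ x < y ] ≡ 0
  [<]≡0 y≤x = 𝟙-no (x Fin.<? y) (ℕₚ.≤⇒≯ y≤x)

  δ≡0 : x ≢ y → δ x y ≡ 0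
  δ≡0 = 𝟙-no (x Finₚ.≟ y)

δ-refl : (x : Fin N) → δ x x ≡ 1
δ-refl x = 𝟙-yes (x Finₚ.≟ x) refl

[<]-irrefl : (x : Fin N) → [ x < x ] ≡ 0
[<]-irrefl x = [<]≡0 (Finₚ.≤-refl {x = x})

between≤1 : (i j r : Fin N) → between i j r ℕ.≤ 1
between≤1 i j r = ℕₚ.*-mono-≤ {_} {1} {_} {1} (𝟙≤1 (i Fin.<? r)) (𝟙≤1 (r Fin.<? j))

module _ {i j r : Fin N} where

  between≡1 : i < r → r < j → between i j r ≡ 1
  between≡1 i<r r<j rewrite [<]≡1 i<r | [<]≡1 r<j = refl

  between≡1⇒ : between i j r ≡ 1 → i < r × r < j
  between≡1⇒ eq = 𝟙≡1⇒ (i Fin.<? r) (ℕₚ.m*n≡1⇒m≡1 [ i < r ] [ r < j ] eq)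
                , 𝟙≡1⇒ (r Fin.<? j) (ℕₚ.m*n≡1⇒n≡1 [ i < r ] [ r < j ] eq)

module _ {a b x : Fin N} where

  outer≤inner : a < b → x ≢ a → x ≢ b → [ x < a ] + [ b < x ] ℕ.≤ [ x < b ] + [ a < x ]
  outer≤inner a<b x≢a x≢b with Finₚ.<-cmp x a | Finₚ.<-cmp x b
  ... | tri≈ _ x≡a _ | _ = ⊥-elim (x≢a x≡a)
  ... | _ | tri≈ _ x≡b _ = ⊥-elim (x≢b x≡b)
  ... | tri< x<a _ _ | _
    rewrite [<]≡1 x<a | [<]≡1 (Finₚ.<-trans x<a a<b)
          | [<]≡0 {x = b} (ℕₚ.<⇒≤ (Finₚ.<-trans x<a a<b)) | [<]≡0 {x = a} (ℕₚ.<⇒≤ x<a)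
    = ℕₚ.≤-refl
  ... | tri> _ _ a<x | tri< x<b _ _
    rewrite [<]≡0 {x = x} (ℕₚ.<⇒≤ a<x) | [<]≡0 {x = b} (ℕₚ.<⇒≤ x<b) | [<]≡1 x<b | [<]≡1 a<x
    = z≤n
  ... | tri> _ _ a<x | tri> _ _ b<x
    rewrite [<]≡0 {x = x} (ℕₚ.<⇒≤ a<x) | [<]≡1 b<x | [<]≡0 {x = x} (ℕₚ.<⇒≤ b<x) | [<]≡1 a<x
    = ℕₚ.≤-refl

  outer<inner : a < x → x < b → [ x < a ] + [ b < x ] ℕ.< [ x < b ] + [ a < x ]
  outer<inner a<x x<b
    rewrite [<]≡0 {x = x} (ℕₚ.<⇒≤ a<x) | [<]≡0 {x = b} (ℕₚ.<⇒≤ x<b) | [<]≡1 x<b | [<]≡1 a<x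
    = s≤s z≤n

  inner<2 : ¬ (a < x × x < b) → [ x < b ] + [ a < x ] ℕ.< 2
  inner<2 ¬a<x<b with x Fin.<? b
  ... | no x≮b rewrite [<]≡0 {x = x} (ℕₚ.≮⇒≥ x≮b) = s≤s (𝟙≤1 (a Fin.<? x))
  ... | yes x<b rewrite [<]≡1 x<b | [<]≡0 {x = a} (ℕₚ.≮⇒≥ (λ a<x → ¬a<x<b (a<x , x<b))) = s≤s (s≤s z≤n)

sum-δ : (a : Fin N) (f : Fin N → ℕ) → sum (λ p → δ p a * f p) ≡ f a
sum-δ {suc N} Fin.zero f = begin
  f Fin.zero + 0 + sum {N} (λ _ → 0) ≡⟨ cong (f Fin.zero + 0 +_) (sum-replicate-zero N) ⟩
  f Fin.zero + 0 + 0                 ≡⟨ ℕₚ.+-identityʳ _ ⟩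
  f Fin.zero + 0                     ≡⟨ ℕₚ.+-identityʳ _ ⟩
  f Fin.zero                         ∎
  where open ≡-Reasoning
sum-δ {suc N} (Fin.suc a) f = sum-δ a (f ∘ Fin.suc)

sum-mono-≤ : {f g : Fin N → ℕ} → (∀ r → f r ℕ.≤ g r) → sum f ℕ.≤ sum g
sum-mono-≤ {zero} f≤g = z≤n
sum-mono-≤ {suc N} f≤g = ℕₚ.+-mono-≤ (f≤g Fin.zero) (sum-mono-≤ (f≤g ∘ Fin.suc))

sum-mono-< : {f g : Fin N → ℕ} → (∀ r → f r ℕ.≤ g r) → ∀ r₀ → f r₀ ℕ.< g r₀ → sum f ℕ.< sum g
sum-mono-< {suc N} f≤g Fin.zero f<g = ℕₚ.+-mono-<-≤ f<g (sum-mono-≤ (f≤g ∘ Fin.suc))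
sum-mono-< {suc N} f≤g (Fin.suc r₀) f<g = ℕₚ.+-mono-≤-< (f≤g Fin.zero) (sum-mono-< (f≤g ∘ Fin.suc) r₀ f<g)

*-mono-≤-when-≡1 : ∀ b {x y} → b ℕ.≤ 1 → (b ≡ 1 → x ℕ.≤ y) → b * x ℕ.≤ b * y
*-mono-≤-when-≡1 zero _ _ = z≤n
*-mono-≤-when-≡1 (suc zero) _ x≤y = ℕₚ.+-monoˡ-≤ 0 (x≤y refl)
*-mono-≤-when-≡1 (suc (suc _)) (s≤s ()) _

≤-when-≡1 : ∀ {x y} → x ℕ.≤ 1 → (x ≡ 1 → x ℕ.≤ y) → x ℕ.≤ y
≤-when-≡1 z≤n _ = z≤n
≤-when-≡1 (s≤s z≤n) x≤y = x≤y refl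

-- The inversion count

length-filter≡sum-𝟙 : ∀ {a} {A : Set a} {R : Pred A p} (R? : Decidable R) (xs : List A) →
  length (filter R? xs) ≡ List.sum (map (𝟙 ∘ R?) xs)
length-filter≡sum-𝟙 R? [] = refl
length-filter≡sum-𝟙 R? (x ∷ xs) with R? x
... | yes _ = cong suc (length-filter≡sum-𝟙 R? xs)
... | no _ = length-filter≡sum-𝟙 R? xs

sum-tabulate : (f : Fin N → ℕ) → List.sum (tabulate f) ≡ sum f
sum-tabulate {zero} f = refl
sum-tabulate {suc N} f = cong (f Fin.zero +_) (sum-tabulate (f ∘ Fin.suc))

sum-cartesianProduct : ∀ {a b} {A : Set a} {B : Set b} (g : A × B → ℕ) (xs : List A) (ys : List B) →
  List.sum (map g (cartesianProduct xs ys)) ≡ List.sum (map (λ x → List.sum (map (g ∘ (x ,_)) ys)) xs)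
sum-cartesianProduct g [] ys = refl
sum-cartesianProduct g (x ∷ xs) ys = begin
  List.sum (map g (map (x ,_) ys ++ cartesianProduct xs ys))
    ≡⟨ cong List.sum (Listₚ.map-++ g (map (x ,_) ys) _) ⟩
  List.sum (map g (map (x ,_) ys) ++ map g (cartesianProduct xs ys))
    ≡⟨ sum-++ (map g (map (x ,_) ys)) _ ⟩
  List.sum (map g (map (x ,_) ys)) + List.sum (map g (cartesianProduct xs ys))
    ≡⟨ cong₂ _+_ (cong List.sum (sym (Listₚ.map-∘ ys))) (sum-cartesianProduct g xs ys) ⟩
  List.sum (map (g ∘ (x ,_)) ys) + List.sum (map (λ x → List.sum (map (g ∘ (x ,_)) ys)) xs) ∎
  where open ≡-Reasoning

sum-map-allFin : (f : Fin N → ℕ) → List.sum (map f (allFin N)) ≡ sum f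
sum-map-allFin f = trans (cong List.sum (Listₚ.map-tabulate id f)) (sum-tabulate f)

inversions : Permutation′ N → ℕ
inversions w = sum λ p → sum λ q → [ p < q ] * [ w ⟨$⟩ʳ q < w ⟨$⟩ʳ p ]

inv≡inversions : ∀ {n} (w : Perm n) → inv w ≡ inversions w
inv≡inversions {n} w = begin
  length (filter R? (cartesianProduct all all))
    ≡⟨ length-filter≡sum-𝟙 R? (cartesianProduct all all) ⟩
  List.sum (map (𝟙 ∘ R?) (cartesianProduct all all))
    ≡⟨ sum-cartesianProduct (𝟙 ∘ R?) all all ⟩
  List.sum (map (λ p → List.sum (map (λ q → 𝟙 (R? (p , q))) all)) all)
    ≡⟨ sum-map-allFin (λ p → List.sum (map (λ q → 𝟙 (R? (p , q))) all)) ⟩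
  sum (λ p → List.sum (map (λ q → 𝟙 (R? (p , q))) all))
    ≡⟨ sum-cong-≗ (λ p → sum-map-allFin (λ q → 𝟙 (R? (p , q)))) ⟩
  sum (λ p → sum (λ q → 𝟙 (R? (p , q))))
    ≡⟨ sum-cong-≗ (λ p → sum-cong-≗ (λ q → 𝟙-×-dec (p Fin.<? q) ((w ⟨$⟩ʳ q) Fin.<? (w ⟨$⟩ʳ p)))) ⟩
  inversions w ∎
  where
  open ≡-Reasoning
  all = allFin (suc n)
  R? : (pq : Fin (suc n) × Fin (suc n)) → Dec (proj₁ pq < proj₂ pq × w ⟨$⟩ʳ proj₂ pq < w ⟨$⟩ʳ proj₁ pq)
  R? (p , q) = (p Fin.<? q) ×-dec ((w ⟨$⟩ʳ q) Fin.<? (w ⟨$⟩ʳ p))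

-- Transpositions and the exchange formula for the inversions of u s_ij

module _ (i j : Fin N) where

  transpose-left : PC.transpose i j i ≡ j
  transpose-left rewrite dec-true (i Finₚ.≟ i) refl = refl

  transpose-right : PC.transpose i j j ≡ i
  transpose-right with j Finₚ.≟ i
  ... | yes j≡i = j≡i
  ... | no _ rewrite dec-true (j Finₚ.≟ j) refl = refl

  transpose-fixes : ∀ {r} → r ≢ i → r ≢ j → PC.transpose i j r ≡ r
  transpose-fixes {r} r≢i r≢j rewrite dec-false (r Finₚ.≟ i) r≢i | dec-false (r Finₚ.≟ j) r≢j = refl

data Position {N} (i j : Fin N) : Fin N → Set where
  at-i : Position i j i
  at-j : Position i j j
  elsewhere : ∀ {r} → r ≢ i → r ≢ j → Position i j r

position : (i j r : Fin N) → Position i j r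
position i j r with r Finₚ.≟ i | r Finₚ.≟ j
... | yes refl | _ = at-i
... | no _ | yes refl = at-j
... | no r≢i | no r≢j = elsewhere r≢i r≢j

transpose-involutive : (i j r : Fin N) → PC.transpose i j (PC.transpose i j r) ≡ r
transpose-involutive i j r with position i j r
... | at-i = trans (cong (PC.transpose i j) (transpose-left i j)) (transpose-right i j)
... | at-j = trans (cong (PC.transpose i j) (transpose-right i j)) (transpose-left i j)
... | elsewhere r≢i r≢j = trans (cong (PC.transpose i j) (transpose-fixes i j r≢i r≢j)) (transpose-fixes i j r≢i r≢j)

⟨$⟩ʳ-injective : (u : Permutation′ N) {p q : Fin N} → u ⟨$⟩ʳ p ≡ u ⟨$⟩ʳ q → p ≡ q
⟨$⟩ʳ-injective u {p} {q} eq = trans (sym (Perm.inverseˡ u)) (trans (cong (u ⟨$⟩ˡ_) eq) (Perm.inverseˡ u))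

corrections : (Fin N → ℕ) → Fin N → Fin N → Fin N → Fin N → ℕ
corrections B a b p q = δ p a * δ q b + δ p a * B q + δ q b * B p

sum-corrections : (B : Fin N → ℕ) (a b : Fin N) (c : Fin N → Fin N → ℕ) →
  sum (λ p → sum (λ q → corrections B a b p q * c p q)) ≡ c a b + sum (λ r → B r * (c a r + c r b))
sum-corrections {N} B a b c = begin
  sum (λ p → sum (λ q → corrections B a b p q * c p q)) ≡⟨ sum-cong-≗ row-expansion ⟩
  sum (λ p → δ p a * row p + B p * c p b)               ≡⟨ ∑-distrib-+ (λ p → δ p a * row p) (λ p → B p * c p b) ⟩
  sum (λ p → δ p a * row p) + sum (λ p → B p * c p b)   ≡⟨ cong (_+ sum (λ p → B p * c p b)) (sum-δ a row) ⟩
  row a + sum (λ p → B p * c p b)                       ≡⟨ cong (_+ sum (λ p → B p * c p b)) row-a ⟩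
  c a b + sum (λ r → B r * c a r) + sum (λ r → B r * c r b)
    ≡⟨ ℕₚ.+-assoc (c a b) _ _ ⟩
  c a b + (sum (λ r → B r * c a r) + sum (λ r → B r * c r b))
    ≡⟨ cong (c a b +_) (sym (∑-distrib-+ (λ r → B r * c a r) (λ r → B r * c r b))) ⟩
  c a b + sum (λ r → B r * c a r + B r * c r b)
    ≡⟨ cong (c a b +_) (sum-cong-≗ (λ r → sym (ℕₚ.*-distribˡ-+ (B r) (c a r) (c r b)))) ⟩
  c a b + sum (λ r → B r * (c a r + c r b)) ∎
  where
  open ≡-Reasoning
  row : Fin N → ℕ
  row p = sum (λ q → δ q b * c p q + B q * c p q)

  expand : ∀ d e f g x → (d * e + d * f + e * g) * x ≡ d * (e * x + f * x) + e * (g * x)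
  expand = solve-∀

  row-expansion : ∀ p → sum (λ q → corrections B a b p q * c p q) ≡ δ p a * row p + B p * c p b
  row-expansion p = begin
    sum (λ q → corrections B a b p q * c p q)
      ≡⟨ sum-cong-≗ (λ q → expand (δ p a) (δ q b) (B q) (B p) (c p q)) ⟩
    sum (λ q → δ p a * (δ q b * c p q + B q * c p q) + δ q b * (B p * c p q))
      ≡⟨ ∑-distrib-+ (λ q → δ p a * (δ q b * c p q + B q * c p q)) (λ q → δ q b * (B p * c p q)) ⟩
    sum (λ q → δ p a * (δ q b * c p q + B q * c p q)) + sum (λ q → δ q b * (B p * c p q))
      ≡⟨ cong₂ _+_ (sym (*-distribˡ-sum (δ p a) (λ q → δ q b * c p q + B q * c p q))) (sum-δ b (λ q → B p * c p q)) ⟩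
    δ p a * row p + B p * c p b ∎

  row-a : row a ≡ c a b + sum (λ r → B r * c a r)
  row-a = trans (∑-distrib-+ (λ q → δ q b * c a q) (λ q → B q * c a q)) (cong (_+ sum (λ r → B r * c a r)) (sum-δ b (c a)))

module Exchange {i j : Fin N} (i<j : i < j) where

  private
    i≢j : i ≢ j
    i≢j = Finₚ.<⇒≢ i<j

    t : Fin N → Fin N
    t = PC.transpose i j

    X Y : Fin N → Fin N → ℕ
    X = corrections (between i j) i j
    Y = corrections (between i j) j i

  between-left : between i j i ≡ 0
  between-left rewrite [<]-irrefl i = refl

  between-right : between i j j ≡ 0
  between-right rewrite [<]-irrefl j = ℕₚ.*-zeroʳ [ i < j ]

  [j<r]+between : ∀ {r} → r ≢ i → r ≢ j → [ j < r ] + between i j r ≡ [ i < r ]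
  [j<r]+between {r} r≢i r≢j with Finₚ.<-cmp r i | Finₚ.<-cmp r j
  ... | tri≈ _ r≡i _ | _ = ⊥-elim (r≢i r≡i)
  ... | _ | tri≈ _ r≡j _ = ⊥-elim (r≢j r≡j)
  ... | tri< r<i _ _ | _ rewrite [<]≡0 {x = j} (ℕₚ.<⇒≤ (Finₚ.<-trans r<i i<j)) | [<]≡0 {x = i} (ℕₚ.<⇒≤ r<i) = refl
  ... | tri> _ _ i<r | tri< r<j _ _ rewrite [<]≡0 {x = j} (ℕₚ.<⇒≤ r<j) | [<]≡1 i<r | [<]≡1 r<j = refl
  ... | tri> _ _ i<r | tri> _ _ j<r rewrite [<]≡1 j<r | [<]≡1 i<r | [<]≡0 {x = r} (ℕₚ.<⇒≤ j<r) = refl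

  [r<i]+between : ∀ {r} → r ≢ i → r ≢ j → [ r < i ] + between i j r ≡ [ r < j ]
  [r<i]+between {r} r≢i r≢j with Finₚ.<-cmp r i | Finₚ.<-cmp r j
  ... | tri≈ _ r≡i _ | _ = ⊥-elim (r≢i r≡i)
  ... | _ | tri≈ _ r≡j _ = ⊥-elim (r≢j r≡j)
  ... | tri< r<i _ _ | _ rewrite [<]≡1 r<i | [<]≡1 (Finₚ.<-trans r<i i<j) | [<]≡0 {x = i} (ℕₚ.<⇒≤ r<i) = refl
  ... | tri> _ _ i<r | tri< r<j _ _ rewrite [<]≡0 {x = r} (ℕₚ.<⇒≤ i<r) | [<]≡1 i<r | [<]≡1 r<j = refl
  ... | tri> _ _ i<r | tri> _ _ j<r rewrite [<]≡0 {x = r} (ℕₚ.<⇒≤ i<r) | [<]≡1 i<r | [<]≡0 {x = r} (ℕₚ.<⇒≤ j<r) = refl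

  -- X counts the pairs p < q that t puts out of order, namely (i, j), (i, r) and (r, j) with
  -- i < r < j; Y counts their reverses, which t puts in order.
  [<]-transpose : ∀ p q → [ t p < t q ] + X p q ≡ [ p < q ] + Y p q
  [<]-transpose p q with position i j p | position i j q
  ... | at-i | at-i
    rewrite between-left | transpose-left i j | [<]-irrefl i | [<]-irrefl j | δ-refl i | δ≡0 i≢j = refl
  ... | at-i | at-j
    rewrite between-left | between-right | transpose-left i j | transpose-right i j
          | [<]≡1 i<j | [<]≡0 (ℕₚ.<⇒≤ i<j) | δ-refl i | δ-refl j | δ≡0 i≢j | δ≡0 (i≢j ∘ sym) = refl
  ... | at-i | elsewhere q≢i q≢j
    rewrite transpose-left i j | transpose-fixes i j q≢i q≢j | δ-refl i | δ≡0 i≢j | δ≡0 q≢i | δ≡0 q≢j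
          | ℕₚ.+-identityʳ (between i j q) | ℕₚ.+-identityʳ (between i j q) | ℕₚ.+-identityʳ [ i < q ]
    = [j<r]+between q≢i q≢j
  ... | at-j | at-i
    rewrite between-left | between-right | transpose-left i j | transpose-right i j
          | [<]≡1 i<j | [<]≡0 (ℕₚ.<⇒≤ i<j) | δ-refl i | δ-refl j | δ≡0 i≢j | δ≡0 (i≢j ∘ sym) = refl
  ... | at-j | at-j
    rewrite between-right | transpose-right i j | [<]-irrefl i | [<]-irrefl j | δ-refl j | δ≡0 (i≢j ∘ sym) = refl
  ... | at-j | elsewhere q≢i q≢j
    rewrite between-right | transpose-right i j | transpose-fixes i j q≢i q≢j | δ-refl j | δ≡0 (i≢j ∘ sym) | δ≡0 q≢i | δ≡0 q≢j
          | ℕₚ.+-identityʳ (between i j q) | ℕₚ.+-identityʳ (between i j q) | ℕₚ.+-identityʳ [ i < q ]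
    = sym ([j<r]+between q≢i q≢j)
  ... | elsewhere p≢i p≢j | at-i
    rewrite between-left | transpose-left i j | transpose-fixes i j p≢i p≢j | δ-refl i | δ≡0 i≢j | δ≡0 p≢i | δ≡0 p≢j
          | ℕₚ.+-identityʳ (between i j p) | ℕₚ.+-identityʳ [ p < j ]
    = sym ([r<i]+between p≢i p≢j)
  ... | elsewhere p≢i p≢j | at-j
    rewrite between-right | transpose-right i j | transpose-fixes i j p≢i p≢j | δ-refl j | δ≡0 (i≢j ∘ sym) | δ≡0 p≢i | δ≡0 p≢j
          | ℕₚ.+-identityʳ (between i j p) | ℕₚ.+-identityʳ [ p < j ]
    = [r<i]+between p≢i p≢j
  ... | elsewhere p≢i p≢j | elsewhere q≢i q≢j
    rewrite transpose-fixes i j p≢i p≢j | transpose-fixes i j q≢i q≢j | δ≡0 p≢i | δ≡0 p≢j | δ≡0 q≢i | δ≡0 q≢j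
    = refl

  module _ (u w : Permutation′ N) (w≡u∘t : ∀ p → w ⟨$⟩ʳ p ≡ u ⟨$⟩ʳ t p) where

    private
      c : Fin N → Fin N → ℕ
      c p q = [ u ⟨$⟩ʳ q < u ⟨$⟩ʳ p ]

    inversions-reindex : inversions w ≡ sum (λ p → sum (λ q → [ t p < t q ] * c p q))
    inversions-reindex = begin
      inversions w
        ≡⟨ ∑-permute (λ p → sum (λ q → [ p < q ] * [ w ⟨$⟩ʳ q < w ⟨$⟩ʳ p ])) (Perm.transpose i j) ⟩
      sum (λ p → sum (λ q → [ t p < q ] * [ w ⟨$⟩ʳ q < w ⟨$⟩ʳ t p ]))
        ≡⟨ sum-cong-≗ (λ p → ∑-permute (λ q → [ t p < q ] * [ w ⟨$⟩ʳ q < w ⟨$⟩ʳ t p ]) (Perm.transpose i j)) ⟩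
      sum (λ p → sum (λ q → [ t p < t q ] * [ w ⟨$⟩ʳ t q < w ⟨$⟩ʳ t p ]))
        ≡⟨ sum-cong-≗ (λ p → sum-cong-≗ (λ q → cong ([ t p < t q ] *_) (cong₂ [_<_] (w∘t q) (w∘t p)))) ⟩
      sum (λ p → sum (λ q → [ t p < t q ] * c p q)) ∎
      where
      open ≡-Reasoning
      w∘t : ∀ p → w ⟨$⟩ʳ t p ≡ u ⟨$⟩ʳ p
      w∘t p = trans (w≡u∘t (t p)) (cong (u ⟨$⟩ʳ_) (transpose-involutive i j p))

    outer inner : Fin N → ℕ
    outer r = [ u ⟨$⟩ʳ r < u ⟨$⟩ʳ i ] + [ u ⟨$⟩ʳ j < u ⟨$⟩ʳ r ]
    inner r = [ u ⟨$⟩ʳ r < u ⟨$⟩ʳ j ] + [ u ⟨$⟩ʳ i < u ⟨$⟩ʳ r ]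

    inversions-transpose :
      inversions w + ([ u ⟨$⟩ʳ j < u ⟨$⟩ʳ i ] + sum (λ r → between i j r * outer r))
      ≡ inversions u + ([ u ⟨$⟩ʳ i < u ⟨$⟩ʳ j ] + sum (λ r → between i j r * inner r))
    inversions-transpose = begin
      inversions w + _                     ≡⟨ cong₂ _+_ inversions-reindex (sym (sum-corrections (between i j) i j c)) ⟩
      ∑∑ (λ p q → [ t p < t q ] * c p q) + ∑∑ (λ p q → X p q * c p q)
        ≡⟨ sym (∑∑-distrib-+ (λ p q → [ t p < t q ] * c p q) (λ p q → X p q * c p q)) ⟩
      ∑∑ (λ p q → [ t p < t q ] * c p q + X p q * c p q) ≡⟨ ∑∑-cong weighted ⟩
      ∑∑ (λ p q → [ p < q ] * c p q + Y p q * c p q)     ≡⟨ ∑∑-distrib-+ (λ p q → [ p < q ] * c p q) (λ p q → Y p q * c p q) ⟩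
      inversions u + ∑∑ (λ p q → Y p q * c p q)         ≡⟨ cong (inversions u +_) (sum-corrections (between i j) j i c) ⟩
      inversions u + _ ∎
      where
      open ≡-Reasoning
      ∑∑ : (Fin N → Fin N → ℕ) → ℕ
      ∑∑ f = sum (λ p → sum (f p))
      ∑∑-cong : ∀ {f g} → (∀ p q → f p q ≡ g p q) → ∑∑ f ≡ ∑∑ g
      ∑∑-cong f≡g = sum-cong-≗ (λ p → sum-cong-≗ (f≡g p))
      ∑∑-distrib-+ : ∀ f g → ∑∑ (λ p q → f p q + g p q) ≡ ∑∑ f + ∑∑ g
      ∑∑-distrib-+ f g = trans (sum-cong-≗ (λ p → ∑-distrib-+ (f p) (g p))) (∑-distrib-+ (λ p → sum (f p)) (λ p → sum (g p)))
      weighted : ∀ p q → [ t p < t q ] * c p q + X p q * c p q ≡ [ p < q ] * c p q + Y p q * c p q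
      weighted p q = begin
        [ t p < t q ] * c p q + X p q * c p q ≡⟨ sym (ℕₚ.*-distribʳ-+ (c p q) [ t p < t q ] (X p q)) ⟩
        ([ t p < t q ] + X p q) * c p q       ≡⟨ cong (_* c p q) ([<]-transpose p q) ⟩
        ([ p < q ] + Y p q) * c p q           ≡⟨ ℕₚ.*-distribʳ-+ (c p q) [ p < q ] (Y p q) ⟩
        [ p < q ] * c p q + Y p q * c p q     ∎

    private
      L R : ℕ
      L = sum (λ r → between i j r * outer r)
      R = sum (λ r → between i j r * inner r)

      image-distinct : ∀ r → between i j r ≡ 1 → u ⟨$⟩ʳ r ≢ u ⟨$⟩ʳ i × u ⟨$⟩ʳ r ≢ u ⟨$⟩ʳ j
      image-distinct r eq with between≡1⇒ eq
      ... | i<r , r<j = (λ eq → Finₚ.<⇒≢ i<r (sym (⟨$⟩ʳ-injective u eq)))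
                      , (λ eq → Finₚ.<⇒≢ r<j (⟨$⟩ʳ-injective u eq))

      descending : u ⟨$⟩ʳ j < u ⟨$⟩ʳ i → inversions w + suc L ≡ inversions u + R
      descending uj<ui = subst₂ (λ m n → inversions w + (m + L) ≡ inversions u + (n + R))
        ([<]≡1 uj<ui) ([<]≡0 {x = u ⟨$⟩ʳ i} (ℕₚ.<⇒≤ uj<ui)) inversions-transpose

      ascending : u ⟨$⟩ʳ i < u ⟨$⟩ʳ j → inversions w + L ≡ inversions u + suc R
      ascending ui<uj = subst₂ (λ m n → inversions w + (m + L) ≡ inversions u + (n + R))
        ([<]≡0 {x = u ⟨$⟩ʳ j} (ℕₚ.<⇒≤ ui<uj)) ([<]≡1 ui<uj) inversions-transpose

      at-between : ∀ {r} → i < r → r < j → (f : Fin N → ℕ) → between i j r * f r ≡ f r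
      at-between i<r r<j f rewrite between≡1 i<r r<j = ℕₚ.*-identityˡ _

    inversions-transpose-descent : u ⟨$⟩ʳ j < u ⟨$⟩ʳ i → inversions w ℕ.< inversions u
    inversions-transpose-descent uj<ui = ℕₚ.+-cancelʳ-≤ L (suc (inversions w)) (inversions u) (begin
      suc (inversions w) + L ≡⟨ sym (ℕₚ.+-suc (inversions w) L) ⟩
      inversions w + suc L   ≡⟨ descending uj<ui ⟩
      inversions u + R       ≤⟨ ℕₚ.+-monoʳ-≤ (inversions u) (sum-mono-≤ R≤L) ⟩
      inversions u + L       ∎)
      where
      open ℕₚ.≤-Reasoning
      R≤L : ∀ r → between i j r * inner r ℕ.≤ between i j r * outer r
      R≤L r = *-mono-≤-when-≡1 (between i j r) (between≤1 i j r) λ eq →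
        let (ur≢ui , ur≢uj) = image-distinct r eq in outer≤inner uj<ui ur≢uj ur≢ui

    inversions-transpose-ascent : u ⟨$⟩ʳ i < u ⟨$⟩ʳ j → ∀ r → i < r → r < j →
      u ⟨$⟩ʳ i < u ⟨$⟩ʳ r → u ⟨$⟩ʳ r < u ⟨$⟩ʳ j → suc (inversions u) ℕ.< inversions w
    inversions-transpose-ascent ui<uj r i<r r<j ui<ur ur<uj = ℕₚ.+-cancelʳ-≤ L (suc (suc (inversions u))) (inversions w) (begin
      suc (suc (inversions u)) + L ≡⟨ sym (ℕₚ.+-suc (suc (inversions u)) L) ⟩
      suc (inversions u) + suc L   ≤⟨ ℕₚ.+-monoʳ-≤ (suc (inversions u)) (sum-mono-< L≤R r L<R) ⟩
      suc (inversions u) + R       ≡⟨ sym (ℕₚ.+-suc (inversions u) R) ⟩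
      inversions u + suc R         ≡⟨ sym (ascending ui<uj) ⟩
      inversions w + L             ∎)
      where
      open ℕₚ.≤-Reasoning
      L≤R : ∀ r → between i j r * outer r ℕ.≤ between i j r * inner r
      L≤R r = *-mono-≤-when-≡1 (between i j r) (between≤1 i j r) λ eq →
        let (ur≢ui , ur≢uj) = image-distinct r eq in outer≤inner ui<uj ur≢ui ur≢uj
      L<R : between i j r * outer r ℕ.< between i j r * inner r
      L<R = subst₂ ℕ._<_ (sym (at-between i<r r<j outer)) (sym (at-between i<r r<j inner)) (outer<inner ui<ur ur<uj)

    inversions-transpose-quantum : u ⟨$⟩ʳ j < u ⟨$⟩ʳ i → ∀ r → i < r → r < j →
      ¬ (u ⟨$⟩ʳ j < u ⟨$⟩ʳ r × u ⟨$⟩ʳ r < u ⟨$⟩ʳ i) → inversions u ℕ.≤ inversions w + 2 * gap i j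
    inversions-transpose-quantum uj<ui r i<r r<j ur∉ = begin
      inversions u             ≤⟨ ℕₚ.m≤m+n (inversions u) R ⟩
      inversions u + R         ≡⟨ sym (descending uj<ui) ⟩
      inversions w + suc L     ≤⟨ ℕₚ.+-monoʳ-≤ (inversions w) (sum-mono-< L≤2 r L<2) ⟩
      inversions w + sum (λ r → between i j r * 2)
        ≡⟨ cong (inversions w +_) (trans (sym (*-distribʳ-sum 2 (between i j))) (ℕₚ.*-comm (gap i j) 2)) ⟩
      inversions w + 2 * gap i j ∎
      where
      open ℕₚ.≤-Reasoning
      L≤2 : ∀ r → between i j r * outer r ℕ.≤ between i j r * 2
      L≤2 r = *-mono-≤-when-≡1 (between i j r) (between≤1 i j r) λ _ →
        ℕₚ.+-mono-≤ (𝟙≤1 ((u ⟨$⟩ʳ r) Fin.<? (u ⟨$⟩ʳ i))) (𝟙≤1 ((u ⟨$⟩ʳ j) Fin.<? (u ⟨$⟩ʳ r)))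
      L<2 : between i j r * outer r ℕ.< between i j r * 2
      L<2 = subst₂ ℕ._<_ (sym (at-between i<r r<j outer)) (sym (at-between i<r r<j (λ _ → 2))) (inner<2 ur∉)

deg≡sum : ∀ {n} (α : Mono n) → deg α ≡ sum α
deg≡sum α = sum-map-allFin α

deg-cong : ∀ {n} {α β : Mono n} → α ≈ₘ β → deg α ≡ deg β
deg-cong {α = α} {β} α≈β = trans (deg≡sum α) (trans (sum-cong-≗ α≈β) (sym (deg≡sum β)))

deg-one : ∀ {n} → deg (one {n}) ≡ 0
deg-one {n} = trans (deg≡sum (one {n})) (sum-replicate-zero n)

qq≡1 : ∀ {n} {i j : Fin (suc n)} {m : Fin n} → toℕ i ℕ.≤ toℕ m → toℕ m ℕ.< toℕ j → qq i j m ≡ 1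
qq≡1 {i = i} {j} {m} i≤m m<j with toℕ i ℕ.≤? toℕ m | toℕ m ℕ.<? toℕ j
... | yes _ | yes _ = refl
... | no i≰m | _ = ⊥-elim (i≰m i≤m)
... | yes _ | no m≮j = ⊥-elim (m≮j m<j)

gap<deg-qq : ∀ {n} {i j : Fin (suc n)} → i < j → gap i j ℕ.< deg (qq i j)
gap<deg-qq {n} {i} {Fin.suc m₀} i<j = subst (gap i j ℕ.<_) (sym (deg≡sum (qq i j))) (sum-mono-< between≤qq m₀ strict)
  where
  j = Fin.suc m₀
  between≤qq : ∀ m → between i j (Fin.suc m) ℕ.≤ qq i j m
  between≤qq m = ≤-when-≡1 (between≤1 i j (Fin.suc m)) λ eq →
    let (i<r , r<j) = between≡1⇒ eq in
    ℕₚ.≤-reflexive (trans eq (sym (qq≡1 (ℕₚ.≤-pred i<r) (ℕₚ.<-trans (ℕₚ.n<1+n (toℕ m)) r<j))))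
  strict : between i j j ℕ.< qq i j m₀
  strict rewrite Exchange.between-right i<j | qq≡1 {i = i} {j} {m₀} (ℕₚ.≤-pred i<j) (ℕₚ.n<1+n (toℕ m₀)) = s≤s z≤n

pos : ∀ {n} → Perm n → Fin (suc n) → ℕ
pos u v = toℕ (u ⟨$⟩ˡ v)

pos-⟨$⟩ʳ : ∀ {n} (u : Perm n) p → pos u (u ⟨$⟩ʳ p) ≡ toℕ p
pos-⟨$⟩ʳ u p = cong toℕ (Perm.inverseˡ u)

pos-injective : ∀ {n} (u : Perm n) {v v′} → pos u v ≡ pos u v′ → v ≡ v′
pos-injective u eq = trans (sym (Perm.inverseʳ u)) (trans (cong (u ⟨$⟩ʳ_) (Finₚ.toℕ-injective eq)) (Perm.inverseʳ u))

record Move {n} (k : Fin n) (x y : Fin (suc n)) (u w : Perm n) : Set where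
  field
    x-left : pos u x ℕ.≤ toℕ k
    y-right : toℕ k ℕ.< pos u y
    swap : IsLeftSwap x y u w
    classical-gap : x < y → ∀ v → x < v → v < y → ¬ (pos u x ℕ.< pos u v × pos u v ℕ.< pos u y)
    quantum-gap : y < x → ∀ v → pos u x ℕ.< pos u v → pos u v ℕ.< pos u y → y < v × v < x

  w⁻¹ : ∀ v → w ⟨$⟩ˡ v ≡ u ⟨$⟩ˡ PC.transpose x y v
  w⁻¹ v = trans (cong (w ⟨$⟩ˡ_) (sym w-at)) (Perm.inverseˡ w)
    where
    w-at : w ⟨$⟩ʳ (u ⟨$⟩ˡ PC.transpose x y v) ≡ v
    w-at = trans (swap _) (trans (cong (PC.transpose x y) (Perm.inverseʳ u)) (transpose-involutive x y v))

  moved-x : pos w x ≡ pos u y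
  moved-x = cong toℕ (trans (w⁻¹ x) (cong (u ⟨$⟩ˡ_) (transpose-left x y)))

  moved-y : pos w y ≡ pos u x
  moved-y = cong toℕ (trans (w⁻¹ y) (cong (u ⟨$⟩ˡ_) (transpose-right x y)))

  unmoved : ∀ {v} → v ≢ x → v ≢ y → pos w v ≡ pos u v
  unmoved v≢x v≢y = cong toℕ (trans (w⁻¹ _) (cong (u ⟨$⟩ˡ_) (transpose-fixes x y v≢x v≢y)))

  x-before-y : pos u x ℕ.< pos u y
  x-before-y = ℕₚ.≤-<-trans x-left y-right

  x-ends-right : toℕ k ℕ.< pos w x
  x-ends-right = subst (toℕ k ℕ.<_) (sym moved-x) y-right

  y-ends-left : pos w y ℕ.≤ toℕ k
  y-ends-left = subst (ℕ._≤ toℕ k) (sym moved-y) x-left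

  private
    pos-flip : ∀ {v v′} → ¬ (pos u v ℕ.< pos u v′) → v ≢ v′ → pos u v′ ℕ.< pos u v
    pos-flip v≮v′ v≢v′ = ℕₚ.≤∧≢⇒< (ℕₚ.≮⇒≥ v≮v′) (λ eq → v≢v′ (sym (pos-injective u eq)))

    outside⇒∉ : y < x → ∀ {v} → x < v ⊎ v < y → ¬ (y < v × v < x)
    outside⇒∉ _ (inj₁ x<v) (_ , v<x) = Finₚ.<-asym x<v v<x
    outside⇒∉ _ (inj₂ v<y) (y<v , _) = Finₚ.<-asym y<v v<y

    outside⇒≢ : y < x → ∀ {v} → x < v ⊎ v < y → v ≢ x × v ≢ y
    outside⇒≢ y<x (inj₁ x<v) = ≢-sym (Finₚ.<⇒≢ x<v) , ≢-sym (Finₚ.<⇒≢ (Finₚ.<-trans y<x x<v))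
    outside⇒≢ y<x (inj₂ v<y) = Finₚ.<⇒≢ (Finₚ.<-trans v<y y<x) , Finₚ.<⇒≢ v<y

  classical-beyond-y : x < y → ∀ {v} → x < v → v < y → pos u x ℕ.< pos u v → pos u y ℕ.< pos u v
  classical-beyond-y x<y x<v v<y px<pv =
    pos-flip (λ pv<py → classical-gap x<y _ x<v v<y (px<pv , pv<py)) (Finₚ.<⇒≢ v<y)

  classical-before-x : x < y → ∀ {v} → x < v → v < y → pos u v ℕ.< pos u y → pos u v ℕ.< pos u x
  classical-before-x x<y x<v v<y pv<py =
    pos-flip (λ px<pv → classical-gap x<y _ x<v v<y (px<pv , pv<py)) (Finₚ.<⇒≢ x<v)

  quantum-beyond-y : y < x → ∀ {v} → x < v ⊎ v < y → pos u x ℕ.< pos u v → pos u y ℕ.< pos u v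
  quantum-beyond-y y<x out px<pv =
    pos-flip (λ pv<py → outside⇒∉ y<x out (quantum-gap y<x _ px<pv pv<py)) (proj₂ (outside⇒≢ y<x out))

  quantum-before-x : y < x → ∀ {v} → x < v ⊎ v < y → pos u v ℕ.< pos u y → pos u v ℕ.< pos u x
  quantum-before-x y<x out pv<py =
    pos-flip (λ px<pv → outside⇒∉ y<x out (quantum-gap y<x _ px<pv pv<py)) (≢-sym (proj₁ (outside⇒≢ y<x out)))

module _ {n} {x y : Fin (suc n)} {u w : Perm n} where

  left-right-swap : ∀ {i j} → IsLeftSwap x y u w → IsRightSwap u i j w →
    u ⟨$⟩ʳ j ≡ PC.transpose x y (u ⟨$⟩ʳ i)
  left-right-swap {i} {j} sx sij = trans (cong (u ⟨$⟩ʳ_) (sym (transpose-left i j))) (trans (sym (sij i)) (sx i))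

  swapped-values : ∀ {i j} → IsLeftSwap x y u w → IsRightSwap u i j w → i ≢ j →
    (u ⟨$⟩ʳ i ≡ x × u ⟨$⟩ʳ j ≡ y) ⊎ (u ⟨$⟩ʳ i ≡ y × u ⟨$⟩ʳ j ≡ x)
  swapped-values {i} {j} sx sij i≢j with left-right-swap sx sij | u ⟨$⟩ʳ i Finₚ.≟ x | u ⟨$⟩ʳ i Finₚ.≟ y
  ... | uj≡ | yes ui≡x | _ = inj₁ (ui≡x , trans uj≡ (trans (cong (PC.transpose x y) ui≡x) (transpose-left x y)))
  ... | uj≡ | no _ | yes ui≡y = inj₂ (ui≡y , trans uj≡ (trans (cong (PC.transpose x y) ui≡y) (transpose-right x y)))
  ... | uj≡ | no ui≢x | no ui≢y = ⊥-elim (i≢j (⟨$⟩ʳ-injective u (sym (trans uj≡ (transpose-fixes x y ui≢x ui≢y)))))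

module _ {n} {u w : Perm n} {β : Mono n} (ℓ≡ : ℓ (β , w) ≡ inv u + 1) where

  inversions-cover : inversions w + 2 * deg β ≡ suc (inversions u)
  inversions-cover = subst₂ (λ a b → a + 2 * deg β ≡ b) (inv≡inversions w)
    (trans (ℕₚ.+-comm (inv u) 1) (cong suc (inv≡inversions u))) ℓ≡

  inversions-classical-cover : β ≈ₘ one → inversions w ≡ suc (inversions u)
  inversions-classical-cover β≈1 = begin
    inversions w              ≡⟨ sym (ℕₚ.+-identityʳ (inversions w)) ⟩
    inversions w + 2 * 0      ≡⟨ cong (λ d → inversions w + 2 * d) (sym (trans (deg-cong β≈1) (deg-one {n}))) ⟩
    inversions w + 2 * deg β  ≡⟨ inversions-cover ⟩
    suc (inversions u)        ∎
    where open ≡-Reasoning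

module _ {n} {u w : Perm n} {k : Fin n} {i j : Fin (suc n)} (i≤k : toℕ i ℕ.≤ toℕ k) (k<j : toℕ k ℕ.< toℕ j) where

  private
    at-pos : ∀ v → u ⟨$⟩ʳ (u ⟨$⟩ˡ v) ≡ v
    at-pos v = Perm.inverseʳ u

  move-from-positions : IsLeftSwap (u ⟨$⟩ʳ i) (u ⟨$⟩ʳ j) u w →
    (u ⟨$⟩ʳ i < u ⟨$⟩ʳ j → ∀ r → i < r → r < j → ¬ (u ⟨$⟩ʳ i < u ⟨$⟩ʳ r × u ⟨$⟩ʳ r < u ⟨$⟩ʳ j)) →
    (u ⟨$⟩ʳ j < u ⟨$⟩ʳ i → ∀ r → i < r → r < j → u ⟨$⟩ʳ j < u ⟨$⟩ʳ r × u ⟨$⟩ʳ r < u ⟨$⟩ʳ i) →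
    Move k (u ⟨$⟩ʳ i) (u ⟨$⟩ʳ j) u w
  move-from-positions sx classical quantum = record
    { x-left = subst (ℕ._≤ toℕ k) (sym (pos-⟨$⟩ʳ u i)) i≤k
    ; y-right = subst (toℕ k ℕ.<_) (sym (pos-⟨$⟩ʳ u j)) k<j
    ; swap = sx
    ; classical-gap = λ ui<uj v ui<v v<uj (pi<pv , pv<pj) →
        classical ui<uj (u ⟨$⟩ˡ v) (subst (ℕ._< pos u v) (pos-⟨$⟩ʳ u i) pi<pv) (subst (pos u v ℕ.<_) (pos-⟨$⟩ʳ u j) pv<pj)
          (subst (u ⟨$⟩ʳ i <_) (sym (at-pos v)) ui<v , subst (_< u ⟨$⟩ʳ j) (sym (at-pos v)) v<uj)
    ; quantum-gap = λ uj<ui v pi<pv pv<pj →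
        let (uj<ur , ur<ui) = quantum uj<ui (u ⟨$⟩ˡ v) (subst (ℕ._< pos u v) (pos-⟨$⟩ʳ u i) pi<pv)
                                                    (subst (pos u v ℕ.<_) (pos-⟨$⟩ʳ u j) pv<pj)
        in subst (u ⟨$⟩ʳ j <_) (at-pos v) uj<ur , subst (_< u ⟨$⟩ʳ i) (at-pos v) ur<ui
    }

quantum-length-mismatch : ∀ {a b g d} → a ℕ.≤ b + 2 * g → g ℕ.< d → b + 2 * d ≢ suc a
quantum-length-mismatch {a} {b} {g} {d} a≤b+2g g<d eq = ℕₚ.<-irrefl refl (begin-strict
  suc a             <⟨ ℕₚ.n<1+n (suc a) ⟩
  2 + a             ≤⟨ ℕₚ.+-monoʳ-≤ 2 a≤b+2g ⟩
  2 + (b + 2 * g)   ≡⟨ two-more b g ⟩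
  b + 2 * suc g     ≤⟨ ℕₚ.+-monoʳ-≤ b (ℕₚ.*-monoʳ-≤ 2 g<d) ⟩
  b + 2 * d         ≡⟨ eq ⟩
  suc a             ∎)
  where
  open ℕₚ.≤-Reasoning
  two-more : ∀ b g → 2 + (b + 2 * g) ≡ b + 2 * suc g
  two-more = solve-∀

module _ {n} {k : Fin n} {u w : Perm n} where

  classical-move : ∀ {x y β} → IsLeftSwap x y u w → x < y → Cover k u (β , w) → β ≈ₘ one → Move k x y u w
  classical-move {x} {y} sx x<y (i , j , i≤k , k<j , sij , _ , ℓ≡) β≈1
    with i<j ← ℕₚ.≤-<-trans i≤k k<j
    with swapped-values {x = x} {y} {u} {w} sx sij (Finₚ.<⇒≢ i<j)
  ... | inj₂ (refl , refl) = ⊥-elim (ℕₚ.<-asym (Exchange.inversions-transpose-descent i<j u w sij x<y) u<w)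
    where u<w = subst (inversions u ℕ.<_) (sym (inversions-classical-cover {u = u} {w} ℓ≡ β≈1)) ℕₚ.≤-refl
  ... | inj₁ (refl , refl) = move-from-positions i≤k k<j sx
    (λ ui<uj r i<r r<j (ui<ur , ur<uj) → ℕₚ.<-irrefl (sym (inversions-classical-cover {u = u} {w} ℓ≡ β≈1))
       (Exchange.inversions-transpose-ascent i<j u w sij ui<uj r i<r r<j ui<ur ur<uj))
    (λ uj<ui → ⊥-elim (Finₚ.<-asym x<y uj<ui))

  quantum-move : ∀ {x y β} → IsLeftSwap x y u w → y < x → pos u x ℕ.< pos u y →
    β ≈ₘ qq (u ⟨$⟩ˡ x) (u ⟨$⟩ˡ y) → Cover k u (β , w) → Move k x y u w
  quantum-move {x} {y} {β} sx y<x px<py β≈qq (i , j , i≤k , k<j , sij , _ , ℓ≡)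
    with i<j ← ℕₚ.≤-<-trans i≤k k<j
    with swapped-values {x = x} {y} {u} {w} sx sij (Finₚ.<⇒≢ i<j)
  ... | inj₂ (refl , refl) = ⊥-elim (ℕₚ.<-asym i<j (subst₂ ℕ._<_ (pos-⟨$⟩ʳ u j) (pos-⟨$⟩ʳ u i) px<py))
  ... | inj₁ (refl , refl) = move-from-positions i≤k k<j sx
    (λ ui<uj → ⊥-elim (Finₚ.<-asym y<x ui<uj))
    (λ uj<ui r i<r r<j → decidable-stable ((u ⟨$⟩ʳ j Fin.<? u ⟨$⟩ʳ r) ×-dec (u ⟨$⟩ʳ r Fin.<? u ⟨$⟩ʳ i)) λ ur∉ →
      quantum-length-mismatch {inversions u} {inversions w} {gap i j} {deg β}
        (Exchange.inversions-transpose-quantum i<j u w sij uj<ui r i<r r<j ur∉)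
        (subst (gap i j ℕ.<_) deg-qq≡deg-β (gap<deg-qq i<j)) (inversions-cover {u = u} {w} ℓ≡))
    where
    deg-qq≡deg-β : deg (qq i j) ≡ deg β
    deg-qq≡deg-β = sym (trans (deg-cong β≈qq) (cong₂ (λ a b → deg (qq a b)) (Perm.inverseˡ u) (Perm.inverseˡ u)))

step⇒move : ∀ {n} {k : Fin n} {x y : Fin (suc n)} {p q : QPerm n} → StepQ k x y p q → Move k x y (proj₂ p) (proj₂ q)
step⇒move (β , inj₁ (x<y , β≈1 , sx , cover) , _) = classical-move sx x<y cover β≈1
step⇒move (β , inj₂ (y<x , px<py , β≈qq , sx , cover) , _) = quantum-move sx y<x px<py β≈qq cover

-- The vanishing words

-- In a word v₁ v₂ v₃ the move mᵢ is the one performed by vᵢ; v₃ acts first, on u₀.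
vanish₃ : ∀ {n} {a₁ b₁ a₂ b₂ a₃ b₃ : Fin (suc n)} →
  (∀ {k u₀ u₁ u₂ u₃} → Move k a₃ b₃ u₀ u₁ → Move k a₂ b₂ u₁ u₂ → Move k a₁ b₁ u₂ u₃ → ⊥) →
  Vanishes n ((a₁ , b₁) ∷ (a₂ , b₂) ∷ (a₃ , b₃) ∷ [])
vanish₃ impossible k x₀ x₃ (step {y = x₂} (step {y = x₁} (step done s₃) s₂) s₁) =
  impossible (step⇒move {p = x₀} {x₁} s₃) (step⇒move {p = x₁} {x₂} s₂) (step⇒move {p = x₂} {x₃} s₁)

open Move

<-transport : ∀ {m n m′ n′} → m ≡ m′ → n ≡ n′ → m′ ℕ.< n′ → m ℕ.< n
<-transport refl refl m′<n′ = m′<n′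

module _ {n} {k : Fin n} {x y x′ y′ : Fin (suc n)} {u₀ u₁ u₂ u₃ : Perm n} where

  crosses-left-twice : ∀ {x″} → Move k x y u₀ u₁ → y ≢ x′ → y ≢ y′ → Move k x′ y′ u₁ u₂ →
    Move k x″ y u₂ u₃ → ⊥
  crosses-left-twice m₃ y≢x′ y≢y′ m₂ m₁ =
    ℕₚ.<⇒≱ (y-right m₁) (subst (ℕ._≤ toℕ k) (sym (unmoved m₂ y≢x′ y≢y′)) (y-ends-left m₃))

  crosses-right-twice : ∀ {y″} → Move k x y u₀ u₁ → x ≢ x′ → x ≢ y′ → Move k x′ y′ u₁ u₂ →
    Move k x y″ u₂ u₃ → ⊥
  crosses-right-twice m₃ x≢x′ x≢y′ m₂ m₁ =
    ℕₚ.<⇒≱ (subst (toℕ k ℕ.<_) (sym (unmoved m₂ x≢x′ x≢y′)) (x-ends-right m₃)) (x-left m₁)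

module _ {n} {a b c : Fin (suc n)} (a<b : a < b) (b<c : b < c) where

  private
    a≢b = Finₚ.<⇒≢ a<b
    b≢c = Finₚ.<⇒≢ b<c
    a≢c = Finₚ.<⇒≢ (Finₚ.<-trans a<b b<c)

  bc·ab·bc : Vanishes n ((b , c) ∷ (a , b) ∷ (b , c) ∷ [])
  bc·ab·bc = vanish₃ λ m₃ m₂ m₁ → crosses-left-twice m₃ (≢-sym a≢c) (≢-sym b≢c) m₂ m₁

  ab·bc·ab : Vanishes n ((a , b) ∷ (b , c) ∷ (a , b) ∷ [])
  ab·bc·ab = vanish₃ λ m₃ m₂ m₁ → crosses-right-twice m₃ a≢b a≢c m₂ m₁

  ca·bc·ca : Vanishes n ((c , a) ∷ (b , c) ∷ (c , a) ∷ [])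
  ca·bc·ca = vanish₃ λ m₃ m₂ m₁ → crosses-left-twice m₃ a≢b a≢c m₂ m₁

  ab·ca·ab : Vanishes n ((a , b) ∷ (c , a) ∷ (a , b) ∷ [])
  ab·ca·ab = vanish₃ λ m₃ m₂ m₁ → crosses-left-twice m₃ b≢c (≢-sym a≢b) m₂ m₁

  bc·ca·bc : Vanishes n ((b , c) ∷ (c , a) ∷ (b , c) ∷ [])
  bc·ca·bc = vanish₃ λ m₃ m₂ m₁ → crosses-right-twice m₃ b≢c (≢-sym a≢b) m₂ m₁

  ca·ab·ca : Vanishes n ((c , a) ∷ (a , b) ∷ (c , a) ∷ [])
  ca·ab·ca = vanish₃ λ m₃ m₂ m₁ → crosses-right-twice m₃ (≢-sym a≢c) (≢-sym b≢c) m₂ m₁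

-- Below, xᵢ in the name of a fact stands for pos uᵢ x.
module _ {n} {a b c d : Fin (suc n)} (a<b : a < b) (b<c : b < c) (c<d : c < d) where

  private
    a<c = Finₚ.<-trans a<b b<c
    b<d = Finₚ.<-trans b<c c<d
    a<d = Finₚ.<-trans a<b b<d
    a≢b = Finₚ.<⇒≢ a<b
    a≢c = Finₚ.<⇒≢ a<c
    a≢d = Finₚ.<⇒≢ a<d
    b≢c = Finₚ.<⇒≢ b<c
    b≢d = Finₚ.<⇒≢ b<d
    c≢d = Finₚ.<⇒≢ c<d

  ac·da·bd : Vanishes n ((a , c) ∷ (d , a) ∷ (b , d) ∷ [])
  ac·da·bd = vanish₃ λ m₃ m₂ m₁ →
    let c₂≡c₀ = trans (unmoved m₂ c≢d (≢-sym a≢c)) (unmoved m₃ (≢-sym b≢c) c≢d)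
        b₀<c₀ = ℕₚ.≤-<-trans (x-left m₃) (subst (_ ℕ.<_) c₂≡c₀ (y-right m₁))
        d₀<c₀ = classical-beyond-y m₃ b<d b<c c<d b₀<c₀
        a₂≡b₀ = trans (moved-y m₂) (moved-y m₃)
        b₂≡d₀ = trans (unmoved m₂ b≢d (≢-sym a≢b)) (moved-x m₃)
    in classical-gap m₁ a<c b a<b b<c (<-transport a₂≡b₀ b₂≡d₀ (x-before-y m₃) , <-transport b₂≡d₀ c₂≡c₀ d₀<c₀)

  bd·ab·ca : Vanishes n ((b , d) ∷ (a , b) ∷ (c , a) ∷ [])
  bd·ab·ca = vanish₃ λ m₃ m₂ m₁ →
    let d₂≡d₀ = trans (unmoved m₂ (≢-sym a≢d) (≢-sym b≢d)) (unmoved m₃ (≢-sym c≢d) (≢-sym a≢d))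
        c₀<d₀ = ℕₚ.≤-<-trans (x-left m₃) (subst (_ ℕ.<_) d₂≡d₀ (y-right m₁))
        a₀<d₀ = quantum-beyond-y m₃ a<c (inj₁ c<d) c₀<d₀
        b₂≡c₀ = trans (moved-y m₂) (moved-y m₃)
        c₂≡a₀ = trans (unmoved m₂ (≢-sym a≢c) (≢-sym b≢c)) (moved-x m₃)
    in classical-gap m₁ b<d c b<c c<d (<-transport b₂≡c₀ c₂≡a₀ (x-before-y m₃) , <-transport c₂≡a₀ d₂≡d₀ a₀<d₀)

  ca·bc·bd : Vanishes n ((c , a) ∷ (b , c) ∷ (b , d) ∷ [])
  ca·bc·bd = vanish₃ λ m₃ m₂ m₁ → ℕₚ.<⇒≱ (x-ends-right m₃) (x-left m₂)

  db·cd·ac : Vanishes n ((d , b) ∷ (c , d) ∷ (a , c) ∷ [])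
  db·cd·ac = vanish₃ λ m₃ m₂ m₁ →
    let b₂≡b₀ = trans (unmoved m₂ b≢c b≢d) (unmoved m₃ (≢-sym a≢b) b≢c)
        a₀<b₀ = ℕₚ.≤-<-trans (x-left m₃) (subst (_ ℕ.<_) b₂≡b₀ (y-right m₁))
        c₀<b₀ = classical-beyond-y m₃ a<c a<b b<c a₀<b₀
        d₂≡a₀ = trans (moved-y m₂) (moved-y m₃)
        a₂≡c₀ = trans (unmoved m₂ a≢c a≢d) (moved-x m₃)
    in Finₚ.<-asym a<b (proj₁ (quantum-gap m₁ b<d a (<-transport d₂≡a₀ a₂≡c₀ (x-before-y m₃))
                                                     (<-transport a₂≡c₀ b₂≡b₀ c₀<b₀)))

  bd·da·ac : Vanishes n ((b , d) ∷ (d , a) ∷ (a , c) ∷ [])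
  bd·da·ac = vanish₃ λ m₃ m₂ m₁ →
    let b₂≡b₀ = trans (unmoved m₂ b≢d (≢-sym a≢b)) (unmoved m₃ (≢-sym a≢b) b≢c)
        b₀<c₀ = ℕₚ.≤-<-trans (subst (ℕ._≤ _) b₂≡b₀ (x-left m₁)) (y-right m₃)
        b₀<a₀ = classical-before-x m₃ a<c a<b b<c b₀<c₀
        c₂≡a₀ = trans (unmoved m₂ c≢d (≢-sym a≢c)) (moved-y m₃)
        d₂≡c₀ = trans (moved-x m₂) (moved-x m₃)
    in classical-gap m₁ b<d c b<c c<d (<-transport b₂≡b₀ c₂≡a₀ b₀<a₀ , <-transport c₂≡a₀ d₂≡c₀ (x-before-y m₃))

  ac·cd·db : Vanishes n ((a , c) ∷ (c , d) ∷ (d , b) ∷ [])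
  ac·cd·db = vanish₃ λ m₃ m₂ m₁ →
    let a₂≡a₀ = trans (unmoved m₂ a≢c a≢d) (unmoved m₃ a≢d a≢b)
        a₀<b₀ = ℕₚ.≤-<-trans (subst (ℕ._≤ _) a₂≡a₀ (x-left m₁)) (y-right m₃)
        a₀<d₀ = quantum-before-x m₃ b<d (inj₂ a<b) a₀<b₀
        b₂≡d₀ = trans (unmoved m₂ b≢c b≢d) (moved-y m₃)
        c₂≡b₀ = trans (moved-x m₂) (moved-x m₃)
    in classical-gap m₁ a<c b a<b b<c (<-transport a₂≡a₀ b₂≡d₀ a₀<d₀ , <-transport b₂≡d₀ c₂≡b₀ (x-before-y m₃))

  db·bc·ca : Vanishes n ((d , b) ∷ (b , c) ∷ (c , a) ∷ [])
  db·bc·ca = vanish₃ λ m₃ m₂ m₁ →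
    let d₂≡d₀ = trans (unmoved m₂ (≢-sym b≢d) (≢-sym c≢d)) (unmoved m₃ (≢-sym c≢d) (≢-sym a≢d))
        d₀<a₀ = ℕₚ.≤-<-trans (subst (ℕ._≤ _) d₂≡d₀ (x-left m₁)) (y-right m₃)
        d₀<c₀ = quantum-before-x m₃ a<c (inj₁ c<d) d₀<a₀
        a₂≡c₀ = trans (unmoved m₂ a≢b a≢c) (moved-y m₃)
        b₂≡a₀ = trans (moved-x m₂) (moved-x m₃)
    in Finₚ.<-asym a<b (proj₁ (quantum-gap m₁ b<d a (<-transport d₂≡d₀ a₂≡c₀ d₀<c₀)
                                                     (<-transport a₂≡c₀ b₂≡a₀ (x-before-y m₃))))

  ca·ab·bd : Vanishes n ((c , a) ∷ (a , b) ∷ (b , d) ∷ [])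
  ca·ab·bd = vanish₃ λ m₃ m₂ m₁ →
    let c₂≡c₀ = trans (unmoved m₂ (≢-sym a≢c) (≢-sym b≢c)) (unmoved m₃ (≢-sym b≢c) c≢d)
        c₀<d₀ = ℕₚ.≤-<-trans (subst (ℕ._≤ _) c₂≡c₀ (x-left m₁)) (y-right m₃)
        c₀<b₀ = classical-before-x m₃ b<d b<c c<d c₀<d₀
        d₂≡b₀ = trans (unmoved m₂ (≢-sym a≢d) (≢-sym b≢d)) (moved-y m₃)
        a₂≡d₀ = trans (moved-x m₂) (moved-x m₃)
    in Finₚ.<-asym c<d (proj₂ (quantum-gap m₁ a<c d (<-transport c₂≡c₀ d₂≡b₀ c₀<b₀)
                                                     (<-transport d₂≡b₀ a₂≡d₀ (x-before-y m₃))))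

theorem6p10 : (n : ℕ) (a b c d : Fin (suc n)) →
  (a < b → b < c →
    Vanishes n ((b , c) ∷ (a , b) ∷ (b , c) ∷ [])
    × Vanishes n ((a , b) ∷ (b , c) ∷ (a , b) ∷ [])
    × Vanishes n ((c , a) ∷ (b , c) ∷ (c , a) ∷ [])
    × Vanishes n ((a , b) ∷ (c , a) ∷ (a , b) ∷ [])
    × Vanishes n ((b , c) ∷ (c , a) ∷ (b , c) ∷ [])
    × Vanishes n ((c , a) ∷ (a , b) ∷ (c , a) ∷ []))
  × (a < b → b < c → c < d →
    Vanishes n ((a , c) ∷ (d , a) ∷ (b , d) ∷ [])
    × Vanishes n ((b , d) ∷ (a , b) ∷ (c , a) ∷ [])
    × Vanishes n ((c , a) ∷ (b , c) ∷ (b , d) ∷ [])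
    × Vanishes n ((d , b) ∷ (c , d) ∷ (a , c) ∷ [])
    × Vanishes n ((b , d) ∷ (d , a) ∷ (a , c) ∷ [])
    × Vanishes n ((a , c) ∷ (c , d) ∷ (d , b) ∷ [])
    × Vanishes n ((d , b) ∷ (b , c) ∷ (c , a) ∷ [])
    × Vanishes n ((c , a) ∷ (a , b) ∷ (b , d) ∷ []))
theorem6p10 n a b c d =
  (λ a<b b<c →
    bc·ab·bc a<b b<c , ab·bc·ab a<b b<c , ca·bc·ca a<b b<c ,
    ab·ca·ab a<b b<c , bc·ca·bc a<b b<c , ca·ab·ca a<b b<c) ,
  (λ a<b b<c c<d →
    ac·da·bd a<b b<c c<d , bd·ab·ca a<b b<c c<d , ca·bc·bd a<b b<c c<d , db·cd·ac a<b b<c c<d ,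
    bd·da·ac a<b b<c c<d , ac·cd·db a<b b<c c<d , db·bc·ca a<b b<c c<d , ca·ab·bd a<b b<c c<d)
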